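{- Let $H_1$ and $H_2$ be simple, undirected, connected graphs of girth at least $6$ on the same vertex set $V$. Suppose that $H_1^2 = H_2^2$ and that $u,v,w\in V$ are three vertices such that $uvw$ is a path in both $H_1$ and $H_2$ (i.e. $uv$ and $vw$ are edges of both graphs, with $u,v,w$ distinct). Then $H_1 = H_2$, i.e. they have the same edge set.
   Context: For a simple, undirected, connected graph $H$, its square $H^2$ is the graph on the same vertex set in which two distinct vertices are adjacent if and only if their distance in $H$ is at most $2$. The girth of a graph is the length of its shortest cycle ($\infty$ for a tree). The equality $H_1=H_2$ means equality of graphs (same vertex set and same edges), not merely isomorphism. -}

module Defs where

open import Data.Nat using (ℕ; suc; _≤_; _<_)
open import Data.Fin using (Fin; zero; suc; inject₁; fromℕ)
open import Data.Bool using (Bool; true; false)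
open import Data.Product using (Σ; _×_; ∃-syntax)
open import Data.Sum using (_⊎_)
open import Relation.Nullary using (¬_)
open import Relation.Binary.PropositionalEquality using (_≡_; _≢_)
open import Function.Definitions using (Injective)
open import Function.Bundles using (_⇔_)

record Graph (n : ℕ) : Set where
  field
    adj   : Fin n → Fin n → Bool
    sym   : ∀ x y → adj x y ≡ adj y x
    irref : ∀ x → adj x x ≡ false

open Graph public

Edge : ∀ {n} → Graph n → Fin n → Fin n → Set
Edge G x y = adj G x y ≡ true

data Walk {n} (G : Graph n) : Fin n → Fin n → Set where
  here : ∀ {x} → Walk G x x
  step : ∀ {x y z} → Edge G x y → Walk G y z → Walk G x z

Connected : ∀ {n} → Graph n → Set
Connected G = ∀ x y → Walk G x y

HasCycleOfLength : ∀ {n} → Graph n → ℕ → Set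
HasCycleOfLength {n} G k = Σ ℕ λ m → (k ≡ suc m) × (3 ≤ k) ×
  (Σ (Fin (suc m) → Fin n) λ f →
     Injective _≡_ _≡_ f ×
     (∀ (i : Fin m) → Edge G (f (inject₁ i)) (f (suc i))) ×
     Edge G (f (fromℕ m)) (f zero))

GirthAtLeast : ∀ {n} → Graph n → ℕ → Set
GirthAtLeast G g = ∀ k → k < g → ¬ HasCycleOfLength G k

SqEdge : ∀ {n} → Graph n → Fin n → Fin n → Set
SqEdge G x y = x ≢ y × (Edge G x y ⊎ ∃[ z ] (Edge G x z × Edge G z y))

SameGraph : ∀ {n} → Graph n → Graph n → Set
SameGraph G H = ∀ x y → adj G x y ≡ adj H x y

SameSquare : ∀ {n} → Graph n → Graph n → Set
SameSquare G H = ∀ x y → SqEdge G x y ⇔ SqEdge H x y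

-- Call a vertex good if its G-neighbours are H-neighbours. In a graph of
-- girth at least 6 a non-backtracking walk x y z s has no shortcut of
-- length at most 2 from x to s; hence a vertex at distance at most 2 from
-- both ends of an edge is adjacent to one of them. Since G² = H², this
-- makes the middle vertex of a path common to G and H good, and then
-- goodness spreads along G-edges from any good vertex with a good
-- neighbour. Connectivity gives E(G) ⊆ E(H), and symmetry the converse.
module Submission where

open import Defs
open import Data.Nat using (ℕ; suc; _≤_; _<_; z≤n; s≤s)
open import Data.Fin using (Fin; zero; suc; inject₁; fromℕ; _≟_)
open import Data.Vec using (Vec; []; _∷_; lookup)
open import Data.Vec.Relation.Unary.All using ([]; _∷_)
open import Data.Vec.Relation.Unary.AllPairs using ([]; _∷_)
open import Data.Vec.Relation.Unary.Linked using (Linked; [-]; _∷_)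
open import Data.Vec.Relation.Unary.Unique.Propositional using (Unique)
open import Data.Vec.Relation.Unary.Unique.Propositional.Properties using (lookup-injective)
open import Data.Bool.Properties using (⇔→≡)
open import Data.Product using (_×_; _,_; proj₁; proj₂; ∃-syntax)
open import Data.Sum using (_⊎_; inj₁; inj₂)
open import Data.Empty using (⊥; ⊥-elim)
open import Relation.Nullary using (¬_; yes; no)
open import Relation.Binary.Core using (Rel)
open import Relation.Binary.PropositionalEquality as ≡ using (_≢_; refl; ≢-sym)
open import Function.Bundles using (Equivalence; mk⇔)
open import Function.Construct.Symmetry using (⇔-sym)

linked-lookup : ∀ {a ℓ} {A : Set a} {R : Rel A ℓ} {m} {xs : Vec A (suc m)} →
                Linked R xs → (i : Fin m) → R (lookup xs (inject₁ i)) (lookup xs (suc i))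
linked-lookup {xs = _ ∷ _ ∷ _} (r ∷ _) zero    = r
linked-lookup {xs = _ ∷ _ ∷ _} (_ ∷ l) (suc i) = linked-lookup l i

module _ {n : ℕ} (G : Graph n) where

  Edge-sym : ∀ {x y} → Edge G x y → Edge G y x
  Edge-sym {x} {y} e = ≡.trans (Graph.sym G y x) e

  Edge⇒≢ : ∀ {x y} → Edge G x y → x ≢ y
  Edge⇒≢ {x} e refl with () ← ≡.trans (≡.sym e) (irref G x)

  cycle-of-vec : ∀ {m} (xs : Vec (Fin n) (suc m)) → 2 ≤ m → Unique xs → Linked (Edge G) xs →
                 Edge G (lookup xs (fromℕ m)) (lookup xs zero) → HasCycleOfLength G (suc m)
  cycle-of-vec {m} xs 2≤m unique linked closing =
    m , refl , s≤s 2≤m , lookup xs , (λ {i} {j} → lookup-injective unique i j) ,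
    linked-lookup linked , closing

module GirthAtLeast6 {n : ℕ} (G : Graph n) (girth : GirthAtLeast G 6) where

  no-short-cycle : ∀ {m} (xs : Vec (Fin n) (suc m)) → 2 ≤ m → m < 5 → Unique xs →
                   Linked (Edge G) xs → Edge G (lookup xs (fromℕ m)) (lookup xs zero) → ⊥
  no-short-cycle xs 2≤m m<5 unique linked closing =
    girth _ (s≤s m<5) (cycle-of-vec G xs 2≤m unique linked closing)

  module _ {a b c : Fin n} where

    no-triangle : Edge G a b → Edge G b c → Edge G c a → ⊥
    no-triangle ab bc ca =
      no-short-cycle (a ∷ b ∷ c ∷ []) (s≤s (s≤s z≤n)) (s≤s (s≤s (s≤s z≤n)))
        ((Edge⇒≢ G ab ∷ ≢-sym (Edge⇒≢ G ca) ∷ []) ∷ (Edge⇒≢ G bc ∷ []) ∷ [] ∷ [])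
        (ab ∷ bc ∷ [-]) ca

    no-square : ∀ {d} → a ≢ c → b ≢ d →
                Edge G a b → Edge G b c → Edge G c d → Edge G d a → ⊥
    no-square {d} a≢c b≢d ab bc cd da =
      no-short-cycle (a ∷ b ∷ c ∷ d ∷ []) (s≤s (s≤s z≤n)) (s≤s (s≤s (s≤s (s≤s z≤n))))
        ((Edge⇒≢ G ab ∷ a≢c ∷ ≢-sym (Edge⇒≢ G da) ∷ []) ∷ (Edge⇒≢ G bc ∷ b≢d ∷ []) ∷
         (Edge⇒≢ G cd ∷ []) ∷ [] ∷ [])
        (ab ∷ bc ∷ cd ∷ [-]) da

    no-pentagon : ∀ {d e} → a ≢ c → a ≢ d → b ≢ d → b ≢ e → c ≢ e →
                  Edge G a b → Edge G b c → Edge G c d → Edge G d e → Edge G e a → ⊥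
    no-pentagon {d} {e} a≢c a≢d b≢d b≢e c≢e ab bc cd de ea =
      no-short-cycle (a ∷ b ∷ c ∷ d ∷ e ∷ []) (s≤s (s≤s z≤n)) (s≤s (s≤s (s≤s (s≤s (s≤s z≤n)))))
        ((Edge⇒≢ G ab ∷ a≢c ∷ a≢d ∷ ≢-sym (Edge⇒≢ G ea) ∷ []) ∷ (Edge⇒≢ G bc ∷ b≢d ∷ b≢e ∷ []) ∷
         (Edge⇒≢ G cd ∷ c≢e ∷ []) ∷ (Edge⇒≢ G de ∷ []) ∷ [] ∷ [])
        (ab ∷ bc ∷ cd ∷ de ∷ [-]) ea

  walk₃-no-shortcut : ∀ {x y z s} → x ≢ z → y ≢ s → x ≢ s →
                      Edge G x y → Edge G y z → Edge G z s →
                      ¬ (Edge G x s ⊎ ∃[ p ] (Edge G x p × Edge G p s))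
  walk₃-no-shortcut x≢z y≢s _ xy yz zs (inj₁ xs) = no-square x≢z y≢s xy yz zs (Edge-sym G xs)
  walk₃-no-shortcut {y = y} {z} x≢z y≢s x≢s xy yz zs (inj₂ (p , xp , ps)) with p ≟ y | p ≟ z
  ... | yes refl | _        = no-triangle yz zs (Edge-sym G ps)
  ... | no _     | yes refl = no-triangle xy yz (Edge-sym G xp)
  ... | no p≢y   | no p≢z   =
    no-pentagon x≢z x≢s y≢s (≢-sym p≢y) (≢-sym p≢z) xy yz zs (Edge-sym G ps) (Edge-sym G xp)

  sqNeighbour-of-edge⇒neighbour : ∀ {a b c} → Edge G a b → SqEdge G c a → SqEdge G c b →
                      Edge G c a ⊎ Edge G c b
  sqNeighbour-of-edge⇒neighbour _ (_ , inj₁ ca) _ = inj₁ ca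
  sqNeighbour-of-edge⇒neighbour _  _ (_ , inj₁ cb) = inj₂ cb
  sqNeighbour-of-edge⇒neighbour {b = b} ab (c≢a , inj₂ (p , cp , pa)) (c≢b , inj₂ q-path) with p ≟ b
  ... | yes refl = inj₂ cp
  ... | no p≢b   = ⊥-elim (walk₃-no-shortcut c≢a p≢b c≢b cp pa ab (inj₂ q-path))

module SquareRigidity {n : ℕ} (G H : Graph n)
                      (girthG : GirthAtLeast G 6) (girthH : GirthAtLeast H 6)
                      (sq : SameSquare G H) where

  open GirthAtLeast6 G girthG using (no-triangle; walk₃-no-shortcut)

  Good : Fin n → Set
  Good a = ∀ {b} → Edge G a b → Edge H a b

  CommonEdge : Fin n → Fin n → Set
  CommonEdge a b = Edge G a b × Edge H a b

  CommonEdge-sym : ∀ {a b} → CommonEdge a b → CommonEdge b a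
  CommonEdge-sym (abG , abH) = Edge-sym G abG , Edge-sym H abH

  sqEdge-G⇒H : ∀ {x y} → SqEdge G x y → SqEdge H x y
  sqEdge-G⇒H {x} {y} = Equivalence.to (sq x y)

  H-neighbour-of-edge : ∀ {a b c} → Edge H a b → SqEdge G c a → SqEdge G c b →
                        Edge H c a ⊎ Edge H c b
  H-neighbour-of-edge ab ca cb =
    GirthAtLeast6.sqNeighbour-of-edge⇒neighbour H girthH ab (sqEdge-G⇒H ca) (sqEdge-G⇒H cb)

  middle-good : ∀ {x y z} → x ≢ z → CommonEdge x y → CommonEdge y z → Good y
  middle-good {x} {y} {z} x≢z (xyG , xyH) (yzG , yzH) {t} ytG with t ≟ x | t ≟ z
  ... | yes refl | _        = Edge-sym H xyH
  ... | no _     | yes refl = yzH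
  ... | no t≢x   | no t≢z
      with H-neighbour-of-edge xyH (t≢x , inj₂ (y , Edge-sym G ytG , Edge-sym G xyG)) t~y
         | H-neighbour-of-edge yzH t~y (t≢z , inj₂ (y , Edge-sym G ytG , yzG))
    where t~y = ≢-sym (Edge⇒≢ G ytG) , inj₁ (Edge-sym G ytG)
  ...   | inj₂ tyH | _        = Edge-sym H tyH
  ...   | _        | inj₁ tyH = Edge-sym H tyH
  ...   | inj₁ txH | inj₂ tzH =
    ⊥-elim (GirthAtLeast6.no-square H girthH x≢z (Edge⇒≢ G ytG) xyH yzH (Edge-sym H tzH) txH)

  end-good : ∀ {x y z} → x ≢ z → CommonEdge x y → CommonEdge y z → Good z
  end-good {x} {y} {z} x≢z (xyG , xyH) (yzG , yzH) {s} zsG with s ≟ y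
  ... | yes refl = Edge-sym H yzH
  ... | no s≢y
      with H-neighbour-of-edge yzH (s≢y , inj₂ (z , Edge-sym G zsG , Edge-sym G yzG))
                                   (≢-sym (Edge⇒≢ G zsG) , inj₁ (Edge-sym G zsG))
  ...   | inj₂ szH = Edge-sym H szH
  ...   | inj₁ syH with x ≟ s
  ...     | yes refl = ⊥-elim (no-triangle xyG yzG zsG)
  ...     | no x≢s   =
    ⊥-elim (walk₃-no-shortcut x≢z (≢-sym s≢y) x≢s xyG yzG zsG
             (proj₂ (Equivalence.from (sq x s) (x≢s , inj₂ (y , xyH , Edge-sym H syH)))))

  Anchored : Fin n → Set
  Anchored a = Good a × ∃[ b ] (Edge G a b × Good b)

  anchored-step : ∀ {a a'} → Anchored a → Edge G a a' → Anchored a'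
  anchored-step {a} {a'} (good-a , b , ab , good-b) aa' with a' ≟ b
  ... | yes refl = good-b , a , Edge-sym G ab , good-a
  ... | no a'≢b  =
    end-good (≢-sym a'≢b) (CommonEdge-sym (ab , good-a ab)) (aa' , good-a aa') ,
    a , Edge-sym G aa' , good-a

  anchored-walk : ∀ {a x} → Walk G a x → Anchored a → Anchored x
  anchored-walk here       anchored = anchored
  anchored-walk (step e w) anchored = anchored-walk w (anchored-step anchored e)

  edges-preserved : Connected G → ∀ {u v w} → u ≢ w → CommonEdge u v → CommonEdge v w →
                    ∀ {x y} → Edge G x y → Edge H x y
  edges-preserved connected {u} {v} {w} u≢w uv vw {x} =
    proj₁ (anchored-walk (connected v x) anchored-v)
    where
    anchored-v : Anchored v
    anchored-v = middle-good u≢w uv vw , u , Edge-sym G (proj₁ uv) ,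
                 end-good (≢-sym u≢w) (CommonEdge-sym vw) (CommonEdge-sym uv)

lemma1 : ∀ {n : ℕ} (H₁ H₂ : Graph n) →
    Connected H₁ → Connected H₂ →
    GirthAtLeast H₁ 6 → GirthAtLeast H₂ 6 →
    SameSquare H₁ H₂ →
    (u v w : Fin n) → u ≢ v → v ≢ w → u ≢ w →
    Edge H₁ u v → Edge H₁ v w → Edge H₂ u v → Edge H₂ v w →
    SameGraph H₁ H₂
lemma1 H₁ H₂ connected₁ connected₂ girth₁ girth₂ sq u v w _ _ u≢w uv₁ vw₁ uv₂ vw₂ x y =
  ⇔→≡ (mk⇔ (SquareRigidity.edges-preserved H₁ H₂ girth₁ girth₂ sq  connected₁
              u≢w (uv₁ , uv₂) (vw₁ , vw₂))
           (SquareRigidity.edges-preserved H₂ H₁ girth₂ girth₁ sq⁻¹ connected₂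
              u≢w (uv₂ , uv₁) (vw₂ , vw₁)))
  where
  sq⁻¹ : SameSquare H₂ H₁
  sq⁻¹ a b = ⇔-sym (sq a b)
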